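{- Let $K$ be a complete graph with an edge-colouring $c\colon E(K)\to[k]$, and let $M$ be a perfect matching of $K$. For an edge $e\in E(K)$ define $w_M(e)=|\{e'\in M : c(e')=c(e)\}|$, and define $g(M)=\sum_{e\in M}w_M(e)=\sum_{i=1}^k m_i(M)^2$, where $m_i(M)$ is the number of edges of $M$ of colour $i$. Let $uv$ and $xy$ be two distinct edges of $M$, and let $M'=(M\setminus\{uv,xy\})\cup\{ux,vy\}$ (again a perfect matching of $K$). If $$w_M(uv)+w_M(xy)-w_M(ux)-w_M(vy)>4,$$ then $g(M')<g(M)$. -}

module Defs where

open import Data.Nat using (ℕ; _+_; _<_)
open import Data.Fin using (Fin; toℕ; _≟_)
open import Data.Fin.Properties using (_<?_)
open import Data.List using (List; filter; map; length)
open import Data.Nat.ListAction using (sum)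
open import Data.List.Base using (allFin)
open import Relation.Binary.PropositionalEquality using (_≡_; _≢_)
open import Relation.Nullary using (yes; no)
open import Data.Product using (_×_)

-- An edge-colouring with k colours
-- assigns to each unordered pair {a,b} (a ≢ b) a colour; we represent it as a
-- symmetric function (values on the diagonal are irrelevant).
Colouring : ℕ → ℕ → Set
Colouring n k = Fin n → Fin n → Fin k

Symmetric : ∀ {n k} → Colouring n k → Set
Symmetric c = ∀ a b → c a b ≡ c b a

-- A perfect matching of K_n, represented by its partner map:
-- μ v is the vertex matched to v.  It must be a fixed-point-free involution.
IsPerfectMatching : ∀ {n} → (Fin n → Fin n) → Set
IsPerfectMatching μ = ∀ v → (μ v ≢ v) × (μ (μ v) ≡ v)

-- Each edge {v, μ v} of M is listed once, by its smaller endpoint.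
edgeReps : ∀ {n} → (Fin n → Fin n) → List (Fin n)
edgeReps {n} μ = filter (λ v → v <? μ v) (allFin n)

matchColours : ∀ {n k} → Colouring n k → (Fin n → Fin n) → List (Fin k)
matchColours c μ = map (λ v → c v (μ v)) (edgeReps μ)

w : ∀ {n k} → Colouring n k → (Fin n → Fin n) → Fin n → Fin n → ℕ
w c μ a b = length (filter (λ i → i ≟ c a b) (matchColours c μ))

g : ∀ {n k} → Colouring n k → (Fin n → Fin n) → ℕ
g c μ = sum (map (λ v → w c μ v (μ v)) (edgeReps μ))

-- M' = (M \ {uv, xy}) ∪ {ux, vy}, where v = μ u and y = μ x.
switch : ∀ {n} → (Fin n → Fin n) → Fin n → Fin n → (Fin n → Fin n)
switch μ u x z with z ≟ u
... | yes _ = x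
... | no _ with z ≟ x
...   | yes _ = u
...   | no _ with z ≟ μ u
...     | yes _ = μ x
...     | no _ with z ≟ μ x
...       | yes _ = μ u
...       | no _ = μ z

-- Write m_t for the number of colour-t edges of M and m′_t for M′.  Counting
-- edges through their endpoints, the two matchings differ only on u, v, x, y,
-- so m′ = m − e_{c(uv)} − e_{c(xy)} + e_{c(ux)} + e_{c(vy)} as vectors over the
-- colours.  Adding two unit vectors e_a + e_b to a vector F raises Σ F_t² by
-- 2 (F_a + F_b + [a = b] + 1); comparing the two ways of reaching m + e_{c(ux)} +
-- e_{c(vy)} shows that g(M) − g(M′) is twice the difference of two such
-- brackets, and the gap hypothesis makes that difference positive.
module Submission where

open import Defs
open import Data.Nat using (ℕ; zero; suc; _+_; _*_; _<_; _≤_; z≤n; s≤s)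
open import Data.Nat.Properties
  using ( +-*-semiring; +-commutativeSemigroup; +-assoc; +-identityʳ; *-distribʳ-+
        ; m≤m+n; ≤-trans; ≤-reflexive; +-monoʳ-≤; +-mono-≤; +-monoʳ-<; *-monoʳ-<
        ; +-cancelʳ-<; module ≤-Reasoning)
open import Data.Nat.ListAction using (sum)
open import Data.Nat.Tactic.RingSolver using (solve-∀)
open import Algebra.Properties.Semiring.Sum +-*-semiring
  using (sum-syntax; sum-cong-≗; ∑-distrib-+; sum-replicate-zero) renaming (sum to ∑)
open import Algebra.Properties.CommutativeSemigroup +-commutativeSemigroup
  using (interchange; x∙yz≈y∙xz; x∙yz≈yx∙z)
open import Data.Fin using (Fin; zero; suc; _≟_)
open import Data.Fin.Properties using (_<?_; <-cmp)
open import Data.Bool using (true; false; if_then_else_)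
open import Data.Empty using (⊥-elim)
open import Data.Product using (proj₁; proj₂)
open import Data.List using (List; []; _∷_; map; filter; length; allFin; tabulate)
open import Data.List.Properties using (map-∘; map-tabulate; map-cong-local)
open import Data.List.Relation.Unary.All as All using ([]; _∷_)
open import Data.List.Relation.Unary.AllPairs using ([]; _∷_)
open import Data.List.Relation.Unary.Any using (here; there)
open import Data.List.Relation.Unary.Unique.Propositional using (Unique)
open import Data.List.Membership.Propositional using (_∉_)
open import Data.Vec.Functional using (updateAt)
open import Data.Vec.Functional.Properties using (updateAt-updates; updateAt-minimal)
open import Relation.Nullary using (yes; no; does)
open import Relation.Nullary.Decidable using (dec-true; dec-false)
open import Relation.Binary.Definitions using (tri<; tri≈; tri>)
open import Relation.Binary.PropositionalEquality
  using (_≡_; _≢_; refl; sym; trans; cong; cong₂; subst₂; ≢-sym; module ≡-Reasoning)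

δ : ∀ {m} → Fin m → Fin m → ℕ
δ a b = if does (a ≟ b) then 1 else 0

δ-refl : ∀ {m} (a : Fin m) → δ a a ≡ 1
δ-refl a rewrite dec-true (a ≟ a) refl = refl

δ≤1 : ∀ {m} (a b : Fin m) → δ a b ≤ 1
δ≤1 a b with does (a ≟ b)
... | true  = s≤s z≤n
... | false = z≤n

∑-δ : ∀ {m} (a : Fin m) (f : Fin m → ℕ) → ∑[ b < m ] (δ a b * f b) ≡ f a
∑-δ {suc m} zero    f = trans (cong₂ _+_ (+-identityʳ (f zero)) (sum-replicate-zero m))
                              (+-identityʳ (f zero))
∑-δ         (suc a) f = ∑-δ a (λ b → f (suc b))

∑-agreeOff-point : ∀ {m} (h h′ : Fin m → ℕ) (a : Fin m) →
                   (∀ v → v ≢ a → h v ≡ h′ v) → ∑ h + h′ a ≡ ∑ h′ + h a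
∑-agreeOff-point {m} h h′ a agree = begin
  ∑ h + h′ a                           ≡⟨ cong (∑ h +_) (∑-δ a (λ _ → h′ a)) ⟨
  ∑ h + ∑[ v < m ] (δ a v * h′ a)      ≡⟨ ∑-distrib-+ h _ ⟨
  ∑[ v < m ] (h v + δ a v * h′ a)      ≡⟨ sum-cong-≗ pointwise ⟩
  ∑[ v < m ] (h′ v + δ a v * h a)      ≡⟨ ∑-distrib-+ h′ _ ⟩
  ∑ h′ + ∑[ v < m ] (δ a v * h a)      ≡⟨ cong (∑ h′ +_) (∑-δ a (λ _ → h a)) ⟩
  ∑ h′ + h a                           ∎
  where
  open ≡-Reasoning
  swap-units : ∀ y z → y + 1 * z ≡ z + 1 * y
  swap-units = solve-∀
  pointwise : ∀ v → h v + δ a v * h′ a ≡ h′ v + δ a v * h a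
  pointwise v with a ≟ v
  ... | yes refl = swap-units (h a) (h′ a)
  ... | no a≢v   = cong (_+ 0) (agree v (≢-sym a≢v))

∑-agreeOff : ∀ {m} (S : List (Fin m)) → Unique S → (h h′ : Fin m → ℕ) →
             (∀ v → v ∉ S → h v ≡ h′ v) →
             ∑ h + sum (map h′ S) ≡ ∑ h′ + sum (map h S)
∑-agreeOff []      []             h h′ agree = cong (_+ 0) (sum-cong-≗ (λ v → agree v λ ()))
∑-agreeOff {m} (a ∷ S) (a∉S ∷ S-uniq) h h′ agree = begin
  ∑ h + (h′ a + sum (map h′ S))     ≡⟨ cong (λ s → ∑ h + (h′ a + sum s)) h₁≡h′-on-S ⟨
  ∑ h + (h′ a + sum (map h₁ S))     ≡⟨ x∙yz≈y∙xz (∑ h) (h′ a) _ ⟩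
  h′ a + (∑ h + sum (map h₁ S))     ≡⟨ cong (h′ a +_) (∑-agreeOff S S-uniq h h₁ h≡h₁-off-S) ⟩
  h′ a + (∑ h₁ + sum (map h S))     ≡⟨ x∙yz≈yx∙z (h′ a) (∑ h₁) _ ⟩
  (∑ h₁ + h′ a) + sum (map h S)     ≡⟨ cong (_+ sum (map h S)) (∑-agreeOff-point h₁ h′ a h₁≡h′-off-a) ⟩
  (∑ h′ + h₁ a) + sum (map h S)     ≡⟨ cong (λ z → (∑ h′ + z) + sum (map h S)) (updateAt-updates a h′) ⟩
  (∑ h′ + h a) + sum (map h S)      ≡⟨ +-assoc (∑ h′) (h a) _ ⟩
  ∑ h′ + (h a + sum (map h S))      ∎
  where
  open ≡-Reasoning
  h₁ : Fin m → ℕ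
  h₁ = updateAt h′ a (λ _ → h a)
  h₁≡h′-off-a : ∀ v → v ≢ a → h₁ v ≡ h′ v
  h₁≡h′-off-a v v≢a = updateAt-minimal v a h′ v≢a
  h₁≡h′-on-S : map h₁ S ≡ map h′ S
  h₁≡h′-on-S = map-cong-local (All.map (λ a≢v → h₁≡h′-off-a _ (≢-sym a≢v)) a∉S)
  h≡h₁-off-S : ∀ v → v ∉ S → h v ≡ h₁ v
  h≡h₁-off-S v v∉S with v ≟ a
  ... | yes refl = sym (updateAt-updates a h′)
  ... | no v≢a   = trans (agree v λ { (here v≡a) → v≢a v≡a ; (there v∈S) → v∉S v∈S })
                         (sym (h₁≡h′-off-a v v≢a))

sumSq : ∀ {m} → (Fin m → ℕ) → ℕ
sumSq {m} F = ∑[ t < m ] (F t * F t)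

sumSq-cong : ∀ {m} {F G : Fin m → ℕ} → (∀ t → F t ≡ G t) → sumSq F ≡ sumSq G
sumSq-cong F≗G = sum-cong-≗ (λ t → cong₂ _*_ (F≗G t) (F≗G t))

sumSq-+δ : ∀ {m} (F : Fin m → ℕ) (a : Fin m) →
           sumSq (λ t → F t + δ a t) ≡ sumSq F + (2 * F a + 1)
sumSq-+δ {m} F a = begin
  sumSq (λ t → F t + δ a t)                                ≡⟨ sum-cong-≗ pointwise ⟩
  ∑[ t < m ] (F t * F t + δ a t * (2 * F t + 1))           ≡⟨ ∑-distrib-+ (λ t → F t * F t) _ ⟩
  sumSq F + ∑[ t < m ] (δ a t * (2 * F t + 1))             ≡⟨ cong (sumSq F +_) (∑-δ a (λ t → 2 * F t + 1)) ⟩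
  sumSq F + (2 * F a + 1)                                  ∎
  where
  open ≡-Reasoning
  square-+1 : ∀ y → (y + 1) * (y + 1) ≡ y * y + 1 * (2 * y + 1)
  square-+1 = solve-∀
  square-+0 : ∀ y → (y + 0) * (y + 0) ≡ y * y + 0 * (2 * y + 1)
  square-+0 = solve-∀
  pointwise : ∀ t → (F t + δ a t) * (F t + δ a t) ≡ F t * F t + δ a t * (2 * F t + 1)
  pointwise t with does (a ≟ t)
  ... | true  = square-+1 (F t)
  ... | false = square-+0 (F t)

sumSq-+δ+δ : ∀ {m} (F : Fin m → ℕ) (a b : Fin m) →
             sumSq (λ t → F t + (δ a t + δ b t)) ≡ sumSq F + 2 * suc (F a + F b + δ a b)
sumSq-+δ+δ F a b = begin
  sumSq (λ t → F t + (δ a t + δ b t))                     ≡⟨ sumSq-cong (λ t → +-assoc (F t) _ _) ⟨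
  sumSq (λ t → (F t + δ a t) + δ b t)                     ≡⟨ sumSq-+δ (λ t → F t + δ a t) b ⟩
  sumSq (λ t → F t + δ a t) + (2 * (F b + δ a b) + 1)     ≡⟨ cong (_+ (2 * (F b + δ a b) + 1)) (sumSq-+δ F a) ⟩
  sumSq F + (2 * F a + 1) + (2 * (F b + δ a b) + 1)       ≡⟨ collect (sumSq F) (F a) (F b) (δ a b) ⟩
  sumSq F + 2 * suc (F a + F b + δ a b)                   ∎
  where
  open ≡-Reasoning
  collect : ∀ s x y d → s + (2 * x + 1) + (2 * (y + d) + 1) ≡ s + 2 * suc (x + y + d)
  collect = solve-∀

sumSq-transfer-< : ∀ {m} (F F′ : Fin m → ℕ) (a b p q : Fin m) →
                   (∀ t → F t + (δ p t + δ q t) ≡ F′ t + (δ a t + δ b t)) →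
                   4 + F p + F q < F a + F b → sumSq F′ < sumSq F
sumSq-transfer-< F F′ a b p q transfer gap =
  +-cancelʳ-< (2 * suc L) (sumSq F′) (sumSq F) (begin-strict
    sumSq F′ + 2 * suc L     <⟨ +-monoʳ-< (sumSq F′) (*-monoʳ-< 2 (s≤s L<R)) ⟩
    sumSq F′ + 2 * suc R     ≡⟨ balance ⟨
    sumSq F + 2 * suc L      ∎)
  where
  open ≤-Reasoning
  L = F p + F q + δ p q
  R = F′ a + F′ b + δ a b

  balance : sumSq F + 2 * suc L ≡ sumSq F′ + 2 * suc R
  balance = trans (sym (sumSq-+δ+δ F p q))
                  (trans (sumSq-cong transfer) (sumSq-+δ+δ F′ a b))

  F≤F′+δ+δ : ∀ t → F t ≤ F′ t + (δ a t + δ b t)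
  F≤F′+δ+δ t = ≤-trans (m≤m+n (F t) _) (≤-reflexive (transfer t))

  Fa≤ : F a ≤ F′ a + 2
  Fa≤ = begin
    F a                       ≤⟨ F≤F′+δ+δ a ⟩
    F′ a + (δ a a + δ b a)    ≡⟨ cong (λ z → F′ a + (z + δ b a)) (δ-refl a) ⟩
    F′ a + suc (δ b a)        ≤⟨ +-monoʳ-≤ (F′ a) (s≤s (δ≤1 b a)) ⟩
    F′ a + 2                  ∎

  Fb≤ : F b ≤ F′ b + (δ a b + 1)
  Fb≤ = ≤-trans (F≤F′+δ+δ b) (≤-reflexive (cong (λ z → F′ b + (δ a b + z)) (δ-refl b)))

  shift-left : ∀ x y → (x + y + 1) + 3 ≡ 4 + x + y
  shift-left = solve-∀
  shift-right : ∀ x y d → (x + 2) + (y + (d + 1)) ≡ (x + y + d) + 3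
  shift-right = solve-∀

  L<R : L < R
  L<R = begin-strict
    L                 ≤⟨ +-monoʳ-≤ (F p + F q) (δ≤1 p q) ⟩
    F p + F q + 1     <⟨ +-cancelʳ-< 3 _ _ (begin-strict
      (F p + F q + 1) + 3                ≡⟨ shift-left (F p) (F q) ⟩
      4 + F p + F q                      <⟨ gap ⟩
      F a + F b                          ≤⟨ +-mono-≤ Fa≤ Fb≤ ⟩
      (F′ a + 2) + (F′ b + (δ a b + 1))  ≡⟨ shift-right (F′ a) (F′ b) (δ a b) ⟩
      R + 3                              ∎) ⟩
    R                 ∎

count : ∀ {k} → Fin k → List (Fin k) → ℕ
count t xs = length (filter (_≟ t) xs)

count-∷ : ∀ {k} (t a : Fin k) (xs : List (Fin k)) → count t (a ∷ xs) ≡ δ a t + count t xs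
count-∷ t a xs with does (a ≟ t)
... | true  = refl
... | false = refl

sum-map-count : ∀ {k} (f : Fin k → ℕ) (xs : List (Fin k)) →
                sum (map f xs) ≡ ∑[ t < k ] (count t xs * f t)
sum-map-count {k} f []       = sym (sum-replicate-zero k)
sum-map-count {k} f (a ∷ xs) = begin
  f a + sum (map f xs)                                      ≡⟨ cong₂ _+_ (sym (∑-δ a f)) (sum-map-count f xs) ⟩
  ∑[ t < k ] (δ a t * f t) + ∑[ t < k ] (count t xs * f t)  ≡⟨ ∑-distrib-+ (λ t → δ a t * f t) _ ⟨
  ∑[ t < k ] (δ a t * f t + count t xs * f t)               ≡⟨ sum-cong-≗ regroup ⟩
  ∑[ t < k ] (count t (a ∷ xs) * f t)                       ∎
  where
  open ≡-Reasoning
  regroup : ∀ t → δ a t * f t + count t xs * f t ≡ count t (a ∷ xs) * f t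
  regroup t = trans (sym (*-distribʳ-+ (f t) (δ a t) (count t xs)))
                    (cong (_* f t) (sym (count-∷ t a xs)))

sum-tabulate : ∀ {n} (h : Fin n → ℕ) → sum (tabulate h) ≡ ∑ h
sum-tabulate {zero}  h = refl
sum-tabulate {suc n} h = cong (h zero +_) (sum-tabulate (λ v → h (suc v)))

multiplicity : ∀ {n k} → Colouring n k → (Fin n → Fin n) → Fin k → ℕ
multiplicity c μ t = count t (matchColours c μ)

g≡sumSq : ∀ {n k} (c : Colouring n k) (μ : Fin n → Fin n) → g c μ ≡ sumSq (multiplicity c μ)
g≡sumSq c μ = trans (cong sum (map-∘ (edgeReps μ)))
                    (sum-map-count (multiplicity c μ) (matchColours c μ))

-- Charging each edge to its smaller endpoint, as edgeReps does, turns colour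
-- counts into sums over vertices.
edgeTally : ∀ {n k} → Colouring n k → Fin k → Fin n → Fin n → ℕ
edgeTally c t a b = if does (a <? b) then δ (c a b) t else 0

module _ {n k : ℕ} (c : Colouring n k) where

  count-matchColours : (μ : Fin n → Fin n) (t : Fin k) (xs : List (Fin n)) →
    count t (map (λ v → c v (μ v)) (filter (λ v → v <? μ v) xs))
      ≡ sum (map (λ v → edgeTally c t v (μ v)) xs)
  count-matchColours μ t []       = refl
  count-matchColours μ t (v ∷ xs) with does (v <? μ v)
  ... | false = count-matchColours μ t xs
  ... | true  = trans (count-∷ t (c v (μ v)) _) (cong (δ (c v (μ v)) t +_) (count-matchColours μ t xs))

  multiplicity≡∑ : (μ : Fin n → Fin n) (t : Fin k) →
                   multiplicity c μ t ≡ ∑[ v < n ] edgeTally c t v (μ v)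
  multiplicity≡∑ μ t = begin
    multiplicity c μ t                                        ≡⟨ count-matchColours μ t (allFin n) ⟩
    sum (map (λ v → edgeTally c t v (μ v)) (allFin n))         ≡⟨ cong sum (map-tabulate (λ v → v) (λ v → edgeTally c t v (μ v))) ⟩
    sum (tabulate (λ v → edgeTally c t v (μ v)))               ≡⟨ sum-tabulate (λ v → edgeTally c t v (μ v)) ⟩
    ∑[ v < n ] edgeTally c t v (μ v)                          ∎
    where open ≡-Reasoning

  edgeTally-pair : Symmetric c → (t : Fin k) {a b : Fin n} → a ≢ b →
                   edgeTally c t a b + edgeTally c t b a ≡ δ (c a b) t
  edgeTally-pair c-sym t {a} {b} a≢b rewrite c-sym b a with <-cmp a b
  ... | tri< a<b _ b≮a rewrite dec-true (a <? b) a<b | dec-false (b <? a) b≮a = +-identityʳ _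
  ... | tri≈ _ a≡b _   = ⊥-elim (a≢b a≡b)
  ... | tri> a≮b _ b<a rewrite dec-false (a <? b) a≮b | dec-true (b <? a) b<a = refl

  edgeTally-matched : Symmetric c → (μ : Fin n → Fin n) → IsPerfectMatching μ →
                      (t : Fin k) (v : Fin n) →
                      edgeTally c t v (μ v) + edgeTally c t (μ v) (μ (μ v)) ≡ δ (c v (μ v)) t
  edgeTally-matched c-sym μ pm t v =
    trans (cong (λ z → edgeTally c t v (μ v) + edgeTally c t (μ v) z) (proj₂ (pm v)))
          (edgeTally-pair c-sym t (≢-sym (proj₁ (pm v))))

module _ {n : ℕ} (μ : Fin n → Fin n) (u x : Fin n) where

  switch-u : switch μ u x u ≡ x
  switch-u with u ≟ u
  ... | yes _   = refl
  ... | no u≢u  = ⊥-elim (u≢u refl)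

  switch-x : x ≢ u → switch μ u x x ≡ u
  switch-x x≢u with x ≟ u
  ... | yes x≡u = ⊥-elim (x≢u x≡u)
  ... | no _ with x ≟ x
  ...   | yes _   = refl
  ...   | no x≢x  = ⊥-elim (x≢x refl)

  switch-μu : μ u ≢ u → μ u ≢ x → switch μ u x (μ u) ≡ μ x
  switch-μu μu≢u μu≢x with μ u ≟ u
  ... | yes e = ⊥-elim (μu≢u e)
  ... | no _ with μ u ≟ x
  ...   | yes e = ⊥-elim (μu≢x e)
  ...   | no _ with μ u ≟ μ u
  ...     | yes _ = refl
  ...     | no ne = ⊥-elim (ne refl)

  switch-μx : μ x ≢ u → μ x ≢ x → μ x ≢ μ u → switch μ u x (μ x) ≡ μ u
  switch-μx μx≢u μx≢x μx≢μu with μ x ≟ u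
  ... | yes e = ⊥-elim (μx≢u e)
  ... | no _ with μ x ≟ x
  ...   | yes e = ⊥-elim (μx≢x e)
  ...   | no _ with μ x ≟ μ u
  ...     | yes e = ⊥-elim (μx≢μu e)
  ...     | no _ with μ x ≟ μ x
  ...       | yes _ = refl
  ...       | no ne = ⊥-elim (ne refl)

  switch-other : ∀ v → v ≢ u → v ≢ x → v ≢ μ u → v ≢ μ x → switch μ u x v ≡ μ v
  switch-other v v≢u v≢x v≢μu v≢μx with v ≟ u
  ... | yes e = ⊥-elim (v≢u e)
  ... | no _ with v ≟ x
  ...   | yes e = ⊥-elim (v≢x e)
  ...   | no _ with v ≟ μ u
  ...     | yes e = ⊥-elim (v≢μu e)
  ...     | no _ with v ≟ μ x
  ...       | yes e = ⊥-elim (v≢μx e)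
  ...       | no _  = refl

module _ {n k : ℕ} (c : Colouring n k) (c-sym : Symmetric c)
         (μ : Fin n → Fin n) (pm : IsPerfectMatching μ)
         (u x : Fin n) (x≢u : x ≢ u) (x≢μu : x ≢ μ u) where

  private
    μ′ : Fin n → Fin n
    μ′ = switch μ u x

    μμ : ∀ v → μ (μ v) ≡ v
    μμ v = proj₂ (pm v)

    u≢μu : u ≢ μ u
    u≢μu = ≢-sym (proj₁ (pm u))

    u≢x : u ≢ x
    u≢x = ≢-sym x≢u

    u≢μx : u ≢ μ x
    u≢μx u≡μx = x≢μu (trans (sym (μμ x)) (cong μ (sym u≡μx)))

    μu≢x : μ u ≢ x
    μu≢x = ≢-sym x≢μu

    μu≢μx : μ u ≢ μ x
    μu≢μx μu≡μx = x≢u (trans (sym (μμ x)) (trans (cong μ (sym μu≡μx)) (μμ u)))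

    x≢μx : x ≢ μ x
    x≢μx = ≢-sym (proj₁ (pm x))

    quad : List (Fin n)
    quad = u ∷ μ u ∷ x ∷ μ x ∷ []

    quad-unique : Unique quad
    quad-unique = (u≢μu ∷ u≢x ∷ u≢μx ∷ []) ∷ (μu≢x ∷ μu≢μx ∷ []) ∷ (x≢μx ∷ []) ∷ [] ∷ []

    regroup : ∀ a b c d → a + (b + (c + (d + 0))) ≡ (a + b) + (c + d)
    regroup = solve-∀

  multiplicity-switch : ∀ t →
    multiplicity c μ t + (δ (c u x) t + δ (c (μ u) (μ x)) t)
      ≡ multiplicity c μ′ t + (δ (c u (μ u)) t + δ (c x (μ x)) t)
  multiplicity-switch t = begin
    multiplicity c μ t + (δ (c u x) t + δ (c (μ u) (μ x)) t)
      ≡⟨ cong₂ _+_ (multiplicity≡∑ c μ t) (sym tally′-quad) ⟩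
    ∑ tally + sum (map tally′ quad)
      ≡⟨ ∑-agreeOff quad quad-unique tally tally′ agree ⟩
    ∑ tally′ + sum (map tally quad)
      ≡⟨ cong₂ _+_ (sym (multiplicity≡∑ c μ′ t)) tally-quad ⟩
    multiplicity c μ′ t + (δ (c u (μ u)) t + δ (c x (μ x)) t)
      ∎
    where
    open ≡-Reasoning
    tally tally′ : Fin n → ℕ
    tally  v = edgeTally c t v (μ v)
    tally′ v = edgeTally c t v (μ′ v)

    agree : ∀ v → v ∉ quad → tally v ≡ tally′ v
    agree v v∉quad = cong (edgeTally c t v) (sym (switch-other μ u x v
      (λ e → v∉quad (here e)) (λ e → v∉quad (there (there (here e))))
      (λ e → v∉quad (there (here e))) (λ e → v∉quad (there (there (there (here e)))))))

    tally-quad : sum (map tally quad) ≡ δ (c u (μ u)) t + δ (c x (μ x)) t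
    tally-quad = trans (regroup (tally u) (tally (μ u)) (tally x) (tally (μ x)))
      (cong₂ _+_ (edgeTally-matched c c-sym μ pm t u) (edgeTally-matched c c-sym μ pm t x))

    tally′-quad : sum (map tally′ quad) ≡ δ (c u x) t + δ (c (μ u) (μ x)) t
    tally′-quad = begin
      sum (map tally′ quad)
        ≡⟨ regroup (tally′ u) (tally′ (μ u)) (tally′ x) (tally′ (μ x)) ⟩
      (tally′ u + tally′ (μ u)) + (tally′ x + tally′ (μ x))
        ≡⟨ interchange (tally′ u) _ _ _ ⟩
      (tally′ u + tally′ x) + (tally′ (μ u) + tally′ (μ x))
        ≡⟨ cong₂ _+_
             (cong₂ (λ y z → edgeTally c t u y + edgeTally c t x z) (switch-u μ u x) (switch-x μ u x x≢u))
             (cong₂ (λ y z → edgeTally c t (μ u) y + edgeTally c t (μ x) z)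
                    (switch-μu μ u x (≢-sym u≢μu) μu≢x)
                    (switch-μx μ u x (≢-sym u≢μx) (≢-sym x≢μx) (≢-sym μu≢μx))) ⟩
      (edgeTally c t u x + edgeTally c t x u) + (edgeTally c t (μ u) (μ x) + edgeTally c t (μ x) (μ u))
        ≡⟨ cong₂ _+_ (edgeTally-pair c c-sym t u≢x) (edgeTally-pair c c-sym t μu≢μx) ⟩
      δ (c u x) t + δ (c (μ u) (μ x)) t
        ∎

claim2p2 : ∀ {n k} (c : Colouring n k) → Symmetric c →
           (μ : Fin n → Fin n) → IsPerfectMatching μ →
           (u x : Fin n) → x ≢ u → x ≢ μ u →
           4 + w c μ u x + w c μ (μ u) (μ x) < w c μ u (μ u) + w c μ x (μ x) →
           g c (switch μ u x) < g c μ
claim2p2 c c-sym μ pm u x x≢u x≢μu gap =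
  subst₂ _<_ (sym (g≡sumSq c (switch μ u x))) (sym (g≡sumSq c μ))
    (sumSq-transfer-< (multiplicity c μ) (multiplicity c (switch μ u x)) _ _ _ _
      (multiplicity-switch c c-sym μ pm u x x≢u x≢μu) gap)
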